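{- Let $(\mathsf P,\mathcal O)$ be a semitopology and $C$ a closed set. Then $C$ is a minimal nonempty regular closed set if and only if $C$ is a minimal closed neighbourhood.
   Context: A semitopology $(\mathsf P,\mathcal O)$: a set $\mathsf P$ with a family of open sets containing $\varnothing,\mathsf P$, closed under arbitrary unions (not necessarily intersections). $\mathrm{interior}(X)$ is the union of all open subsets of $X$; $\overline{X}$ (closure) is the set of points every open neighbourhood of which meets $X$; $C$ is closed when $C=\overline{C}$. A closed set $C$ is regular closed when $C=\overline{\mathrm{interior}(C)}$. A closed neighbourhood is a closed set with nonempty interior. Minimality is with respect to subset inclusion (among nonempty regular closed sets, resp. among closed neighbourhoods). -}

module Defs where

open import Level using (Level; _⊔_; suc)
open import Data.Product using (Σ; ∃; _×_; _,_)
open import Data.Empty.Polymorphic using (⊥)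
open import Data.Unit.Polymorphic using (⊤)
open import Function.Bundles using (_⇔_)

Subset : ∀ {ℓ} → Set ℓ → Set (suc ℓ)
Subset {ℓ} P = P → Set ℓ

module _ {ℓ : Level} {P : Set ℓ} where

  _⊆_ : Subset P → Subset P → Set ℓ
  X ⊆ Y = ∀ p → X p → Y p

  _≐_ : Subset P → Subset P → Set ℓ
  X ≐ Y = (X ⊆ Y) × (Y ⊆ X)

  ∅ : Subset P
  ∅ _ = ⊥

  Full : Subset P
  Full _ = ⊤

  Nonempty : Subset P → Set ℓ
  Nonempty X = ∃ λ p → X p

  ⋃ : {I : Set ℓ} → (I → Subset P) → Subset P
  ⋃ {I} F p = ∃ λ (i : I) → F i p

-- A semitopology: a family of open sets (presented by an index type of
-- open-set codes, to stay within one universe level) containing ∅ and P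
-- and closed under arbitrary unions (not necessarily under intersections).
record Semitopology {ℓ : Level} (P : Set ℓ) : Set (suc ℓ) where
  field
    Opens      : Set ℓ
    ⟦_⟧        : Opens → Subset P
    Open-∅     : ∃ λ o → ⟦ o ⟧ ≐ ∅
    Open-Full  : ∃ λ o → ⟦ o ⟧ ≐ Full
    Open-⋃     : ∀ {I : Set ℓ} (F : I → Opens) → ∃ λ o → ⟦ o ⟧ ≐ ⋃ (λ i → ⟦ F i ⟧)

  Open : Subset P → Set ℓ
  Open X = ∃ λ o → ⟦ o ⟧ ≐ X

module SemitopologyNotions {ℓ : Level} {P : Set ℓ} (S : Semitopology P) where
  open Semitopology S

  interior : Subset P → Subset P
  interior X p = ∃ λ (o : Opens) → ⟦ o ⟧ ⊆ X × ⟦ o ⟧ p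

  closure : Subset P → Subset P
  closure X p = ∀ (o : Opens) → ⟦ o ⟧ p → ∃ λ q → ⟦ o ⟧ q × X q

  Closed : Subset P → Set ℓ
  Closed C = C ≐ closure C

  RegularClosed : Subset P → Set ℓ
  RegularClosed C = Closed C × (C ≐ closure (interior C))

  ClosedNeighbourhood : Subset P → Set ℓ
  ClosedNeighbourhood C = Closed C × Nonempty (interior C)

  MinimalNonemptyRegularClosed : Subset P → Set (suc ℓ)
  MinimalNonemptyRegularClosed C =
    RegularClosed C × Nonempty C ×
    (∀ D → RegularClosed D → Nonempty D → D ⊆ C → C ⊆ D)

  MinimalClosedNeighbourhood : Subset P → Set (suc ℓ)
  MinimalClosedNeighbourhood C =
    ClosedNeighbourhood C ×
    (∀ D → ClosedNeighbourhood D → D ⊆ C → C ⊆ D)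

-- For a closed set D, closure (interior D) is a regular closed subset of D,
-- and a nonempty regular closed set has nonempty interior, because the
-- closure of the empty set is empty. Hence every closed neighbourhood
-- contains a nonempty regular closed set, every nonempty regular closed set
-- is a closed neighbourhood, and minimality transfers in both directions.
module Submission where

open import Defs
open import Level using (Level)
open import Function.Bundles using (_⇔_; mk⇔)
open import Data.Product using (_,_; proj₁; proj₂)
open import Data.Unit.Polymorphic using (tt)

module ClosureInterior {ℓ : Level} {P : Set ℓ} (S : Semitopology P) where
  open Semitopology S
  open SemitopologyNotions S

  ⊆-closure : ∀ X → X ⊆ closure X
  ⊆-closure X p Xp o op = p , op , Xp

  closure-mono : ∀ {X Y} → X ⊆ Y → closure X ⊆ closure Y
  closure-mono X⊆Y p p∈clX o op with p∈clX o op
  ... | q , oq , Xq = q , oq , X⊆Y q Xq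

  closure-idem : ∀ X → closure (closure X) ⊆ closure X
  closure-idem X p p∈clclX o op with p∈clclX o op
  ... | q , oq , q∈clX = q∈clX o oq

  closure-closed : ∀ X → Closed (closure X)
  closure-closed X = ⊆-closure (closure X) , closure-idem X

  closure-nonempty : ∀ {X p} → closure X p → Nonempty X
  closure-nonempty {X} {p} p∈clX with Open-Full
  ... | o , _ , Full⊆o with p∈clX o (Full⊆o p tt)
  ... | q , _ , Xq = q , Xq

  interior-⊆ : ∀ X → interior X ⊆ X
  interior-⊆ X p (o , o⊆X , op) = o⊆X p op

  interior-⊆-interior-closure-interior :
    ∀ X → interior X ⊆ interior (closure (interior X))
  interior-⊆-interior-closure-interior X p (o , o⊆X , op) =
    o , (λ q oq → ⊆-closure (interior X) q (o , o⊆X , oq)) , op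

  closure-interior-⊆ : ∀ {C} → Closed C → closure (interior C) ⊆ C
  closure-interior-⊆ {C} (_ , clC⊆C) p p∈clintC =
    clC⊆C p (closure-mono (interior-⊆ C) p p∈clintC)

  closure-interior-regularClosed : ∀ X → RegularClosed (closure (interior X))
  closure-interior-regularClosed X =
    closure-closed (interior X) ,
    closure-mono (interior-⊆-interior-closure-interior X) ,
    (λ p p∈cl → closure-idem (interior X) p (closure-mono (interior-⊆ _) p p∈cl))

  closure-interior-nonempty : ∀ {X} → Nonempty (interior X) →
    Nonempty (closure (interior X))
  closure-interior-nonempty {X} (p , p∈intX) = p , ⊆-closure (interior X) p p∈intX

  closure-interior-closedNeighbourhood : ∀ {X} → Nonempty (interior X) →
    ClosedNeighbourhood (closure (interior X))
  closure-interior-closedNeighbourhood {X} (p , p∈intX) =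
    closure-closed (interior X) ,
    p , interior-⊆-interior-closure-interior X p p∈intX

  regularClosed⇒closedNeighbourhood : ∀ {C} → RegularClosed C → Nonempty C →
    ClosedNeighbourhood C
  regularClosed⇒closedNeighbourhood (closedC , C⊆clintC , _) (p , Cp) =
    closedC , closure-nonempty (C⊆clintC p Cp)

  minimalNonemptyRegularClosed⇒minimalClosedNeighbourhood : ∀ {C} →
    MinimalNonemptyRegularClosed C → MinimalClosedNeighbourhood C
  minimalNonemptyRegularClosed⇒minimalClosedNeighbourhood
    (regularC , nonemptyC , minimal) =
    regularClosed⇒closedNeighbourhood regularC nonemptyC ,
    λ D (closedD , intD≠∅) D⊆C →
      let clintD⊆D = closure-interior-⊆ closedD
          C⊆clintD = minimal (closure (interior D))
                       (closure-interior-regularClosed D)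
                       (closure-interior-nonempty intD≠∅)
                       (λ q q∈clintD → D⊆C q (clintD⊆D q q∈clintD))
      in λ q Cq → clintD⊆D q (C⊆clintD q Cq)

  minimalClosedNeighbourhood⇒minimalNonemptyRegularClosed : ∀ {C} →
    MinimalClosedNeighbourhood C → MinimalNonemptyRegularClosed C
  minimalClosedNeighbourhood⇒minimalNonemptyRegularClosed
    {C} ((closedC , intC≠∅) , minimal) =
    (closedC , C⊆clintC , closure-interior-⊆ closedC) ,
    (proj₁ intC≠∅ , interior-⊆ C _ (proj₂ intC≠∅)) ,
    λ D regularD nonemptyD →
      minimal D (regularClosed⇒closedNeighbourhood regularD nonemptyD)
    where
    C⊆clintC : C ⊆ closure (interior C)
    C⊆clintC = minimal (closure (interior C))
      (closure-interior-closedNeighbourhood intC≠∅)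
      (closure-interior-⊆ closedC)

-- The closedness hypothesis is redundant: both sides already include it.
proposition5p60 : {ℓ : Level} {P : Set ℓ} (S : Semitopology P) (C : Subset P) →
    SemitopologyNotions.Closed S C →
    (SemitopologyNotions.MinimalNonemptyRegularClosed S C ⇔ SemitopologyNotions.MinimalClosedNeighbourhood S C)
proposition5p60 S C _ =
  mk⇔ minimalNonemptyRegularClosed⇒minimalClosedNeighbourhood
      minimalClosedNeighbourhood⇒minimalNonemptyRegularClosed
  where open ClosureInterior S
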